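{- Let $w,t$ be positive integers and $n=wt$. Let $\phi$ be a worker-task assignment function that assigns the workers $[w]$ to task sets $T\subseteq[n]$ with $|T|=w$ (defined only on sets, not multisets), and let $s$ be the switching cost of $\phi$ computed over pairs of adjacent $w$-element subsets of $[n]$. Then there exists a worker-task assignment function $\phi'$ assigning the workers $[w]$ to task multisets $T$ of size $w$ with elements in $[t]$, such that $\phi'$ has switching cost at most $s$.
   Context: For sets: a worker-task assignment function on task sets assigns to each $w$-element set $T\subseteq[n]$ a bijection $[w]\to T$; two such sets $T_1,T_2$ are adjacent if $|T_1\setminus T_2|=|T_2\setminus T_1|=1$. For multisets: a task multiset is a multiset $T$ of size $w$ with elements in $[t]$, $m_T(j)$ its multiplicity of $j$; a worker-task assignment function assigns to each task multiset $T$ a map $\phi'(T):[w]\to[t]$ with exactly $m_T(j)$ workers mapped to $j$; task multisets $T_1,T_2$ are adjacent if $|T_1\setminus T_2|=|T_2\setminus T_1|=1$ (multiset difference $m_{A\setminus B}(i)=\max(0,m_A(i)-m_B(i))$). In both cases the switching cost between adjacent inputs is the number of workers whose assigned task differs, and the switching cost of the function is its maximum over all adjacent pairs. -}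

module Defs where

open import Data.Nat using (ℕ; zero; suc; _+_; _∸_; _≤_)
open import Data.Fin using (Fin; _≟_)
import Data.Fin as F
open import Data.Fin.Subset using (Subset; _∈_; _─_; ∣_∣)
open import Data.Product using (∃)
open import Relation.Binary.PropositionalEquality using (_≡_)
open import Relation.Nullary using (yes; no)
open import Function.Definitions using (Injective)

sumFin : (k : ℕ) → (Fin k → ℕ) → ℕ
sumFin zero    f = 0
sumFin (suc k) f = f F.zero + sumFin k (λ i → f (F.suc i))

switchCount : {w m : ℕ} → (Fin w → Fin m) → (Fin w → Fin m) → ℕ
switchCount {w} f g = sumFin w (λ i → diff (f i ≟ g i))
  where
  diff : {A : Set} → Relation.Nullary.Dec A → ℕ
  diff (yes _) = 0
  diff (no _)  = 1

AdjacentSets : {n : ℕ} → Subset n → Subset n → Set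
AdjacentSets T₁ T₂ = ∣ T₁ ─ T₂ ∣ ≡ 1 × ∣ T₂ ─ T₁ ∣ ≡ 1
  where open import Data.Product using (_×_)

record SetAssignment (w n : ℕ) : Set where
  field
    assign    : (T : Subset n) → ∣ T ∣ ≡ w → Fin w → Fin n
    into      : ∀ T (p : ∣ T ∣ ≡ w) i → assign T p i ∈ T
    injective : ∀ T (p : ∣ T ∣ ≡ w) → Injective _≡_ _≡_ (assign T p)
    onto      : ∀ T (p : ∣ T ∣ ≡ w) j → j ∈ T → ∃ λ i → assign T p i ≡ j

SetCostAtMost : {w n : ℕ} → SetAssignment w n → ℕ → Set
SetCostAtMost {w} {n} φ s =
  ∀ (T₁ T₂ : Subset n) (p₁ : ∣ T₁ ∣ ≡ w) (p₂ : ∣ T₂ ∣ ≡ w) →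
  AdjacentSets T₁ T₂ →
  switchCount (SetAssignment.assign φ T₁ p₁) (SetAssignment.assign φ T₂ p₂) ≤ s

Multiset : ℕ → Set
Multiset t = Fin t → ℕ

size : {t : ℕ} → Multiset t → ℕ
size {t} m = sumFin t m

_∖_ : {t : ℕ} → Multiset t → Multiset t → Multiset t
(A ∖ B) i = A i ∸ B i

AdjacentMultisets : {t : ℕ} → Multiset t → Multiset t → Set
AdjacentMultisets T₁ T₂ = size (T₁ ∖ T₂) ≡ 1 × size (T₂ ∖ T₁) ≡ 1
  where open import Data.Product using (_×_)

workersOn : {w t : ℕ} → (Fin w → Fin t) → Fin t → ℕ
workersOn {w} f j = sumFin w (λ i → ind (f i ≟ j))
  where
  ind : {A : Set} → Relation.Nullary.Dec A → ℕ
  ind (yes _) = 1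
  ind (no _)  = 0

record MultisetAssignment (w t : ℕ) : Set where
  field
    assign : (T : Multiset t) → size T ≡ w → Fin w → Fin t
    mult   : ∀ T (p : size T ≡ w) j → workersOn (assign T p) j ≡ T j

MultisetCostAtMost : {w t : ℕ} → MultisetAssignment w t → ℕ → Set
MultisetCostAtMost {w} {t} φ s =
  ∀ (T₁ T₂ : Multiset t) (p₁ : size T₁ ≡ w) (p₂ : size T₂ ≡ w) →
  AdjacentMultisets T₁ T₂ →
  switchCount (MultisetAssignment.assign φ T₁ p₁) (MultisetAssignment.assign φ T₂ p₂) ≤ s

module Submission where

-- The universe [w·t] is viewed as a grid
-- Fin w × Fin t (via remQuot/combine): the cell (i , j) is the i-th copy of
-- task j.  A task multiset T of size w is encoded as the set of cells
--   slots T = { (i , j) | i < T j },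
-- i.e. the first T j copies of every task j.  This set has exactly w elements,
-- and |slots T₁ ─ slots T₂| = Σⱼ (T₁ j ∸ T₂ j) = |T₁ ∖ T₂|, so adjacent
-- multisets are sent to adjacent sets.  Given φ on sets, the induced
-- assignment sends worker i to the task (column) of the cell φ(slots T) i.
-- Since φ(slots T) is a bijection onto slots T, exactly T j workers land in
-- column j; and forgetting the copy index can only make two assignments agree
-- more often, so the switching cost does not increase.

open import Defs
open import Data.Nat using (ℕ; zero; suc; _+_; _*_; _∸_; _≤_; _<ᵇ_; z≤n; s≤s)
open import Data.Nat.Properties
  using (+-*-semiring; +-assoc; +-identityʳ; *-identityʳ; *-comm; 0∸n≡0; ≤-trans; m≤m+n; m≤n+m)
open import Data.Bool using (Bool; true; false; _∧_; not)
open import Data.Bool.Properties using (∧-zeroʳ)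
open import Data.Fin using (Fin; toℕ; _≟_; _↑ˡ_; _↑ʳ_; combine; quotient; remainder)
import Data.Fin as F
open import Data.Fin.Properties using (remQuot-combine)
open import Data.Fin.Subset using (Subset; _─_; ∣_∣)
import Data.Fin.Subset as Subset
open import Data.Vec using (_∷_; lookup; tabulate)
open import Data.Vec.Properties using (lookup∘tabulate; []=⇒lookup; lookup⇒[]=)
open import Data.Product using (∃; _,_; proj₁; proj₂)
open import Data.Empty using (⊥-elim)
open import Function using (_∘_; mk⇔)
open import Function.Definitions using (Injective)
open import Relation.Binary.PropositionalEquality
open import Relation.Nullary using (does; yes; no)
open import Relation.Nullary.Decidable using (dec-false; does-⇔)
open import Algebra.Properties.Semiring.Sum +-*-semiring
  using (sum; sum-syntax; sum-cong-≗; sum-replicate-zero; ∑-comm; *-distribˡ-sum; *-distribʳ-sum)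

𝟙 : Bool → ℕ
𝟙 true  = 1
𝟙 false = 0

sumFin≡sum : ∀ k (f : Fin k → ℕ) → sumFin k f ≡ sum f
sumFin≡sum zero    f = refl
sumFin≡sum (suc k) f = cong (f F.zero +_) (sumFin≡sum k (f ∘ F.suc))

term≤sum : ∀ {k} (f : Fin k → ℕ) j → f j ≤ sum f
term≤sum f F.zero    = m≤m+n (f F.zero) _
term≤sum f (F.suc j) = ≤-trans (term≤sum (f ∘ F.suc) j) (m≤n+m _ (f F.zero))

sum-pick : ∀ {k} (c : Fin k → ℕ) y → ∑[ x < k ] (𝟙 (does (x ≟ y)) * c x) ≡ c y
sum-pick {suc k} c F.zero    = begin
  c F.zero + 0 + ∑[ x < k ] 0 ≡⟨ cong₂ _+_ (+-identityʳ _) (sum-replicate-zero k) ⟩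
  c F.zero + 0                  ≡⟨ +-identityʳ _ ⟩
  c F.zero                      ∎
  where open ≡-Reasoning
sum-pick {suc k} c (F.suc y) = sum-pick (c ∘ F.suc) y

sum-++ : ∀ m {n} (f : Fin (m + n) → ℕ) →
  sum f ≡ ∑[ i < m ] (f (i ↑ˡ n)) + ∑[ j < n ] (f (m ↑ʳ j))
sum-++ zero    f = refl
sum-++ (suc m) f = trans (cong (f F.zero +_) (sum-++ m (f ∘ F.suc))) (sym (+-assoc (f F.zero) _ _))

sum-combine : ∀ m {n} (f : Fin (m * n) → ℕ) →
  sum f ≡ ∑[ i < m ] ∑[ j < n ] (f (combine i j))
sum-combine zero    f = refl
sum-combine (suc m) {n} f =
  trans (sum-++ n f) (cong (∑[ j < n ] (f (j ↑ˡ (m * n))) +_) (sum-combine m (f ∘ (n ↑ʳ_))))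

sum-grid : ∀ m n (F : Fin m → Fin n → ℕ) →
  ∑[ x < m * n ] (F (quotient n x) (remainder {m} n x)) ≡ ∑[ j < n ] ∑[ i < m ] (F i j)
sum-grid m n F = begin
  ∑[ x < m * n ] (F (quotient n x) (remainder {m} n x))
    ≡⟨ sum-combine m _ ⟩
  ∑[ i < m ] ∑[ j < n ] (F (quotient n (combine i j)) (remainder {m} n (combine i j)))
    ≡⟨ sum-cong-≗ (λ i → sum-cong-≗ (λ j →
         cong (λ p → F (proj₁ p) (proj₂ p)) (remQuot-combine i j))) ⟩
  ∑[ i < m ] ∑[ j < n ] (F i j)
    ≡⟨ ∑-comm F ⟩
  ∑[ j < n ] ∑[ i < m ] (F i j) ∎
  where open ≡-Reasoning

module Bijection {w N : ℕ} (S : Subset N) (g : Fin w → Fin N)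
  (into : ∀ i → g i Subset.∈ S) (injective : Injective _≡_ _≡_ g)
  (onto : ∀ x → x Subset.∈ S → ∃ λ i → g i ≡ x) where

  preimage-count : ∀ x → ∑[ i < w ] (𝟙 (does (x ≟ g i))) ≡ 𝟙 (lookup S x)
  preimage-count x with lookup S x in x∈S
  ... | true  with onto x (lookup⇒[]= x S x∈S)
  ...   | i₀ , gi₀≡x = begin
    ∑[ i < w ] (𝟙 (does (x ≟ g i)))
      ≡⟨ sum-cong-≗ (λ i → cong 𝟙 (does-⇔ (mk⇔ x≡gi⇒i≡i₀ (λ i≡i₀ → trans (sym gi₀≡x) (cong g (sym i≡i₀))))
                                          (x ≟ g i) (i ≟ i₀))) ⟩
    ∑[ i < w ] (𝟙 (does (i ≟ i₀)))
      ≡⟨ sum-cong-≗ (λ i → sym (*-identityʳ (𝟙 (does (i ≟ i₀))))) ⟩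
    ∑[ i < w ] (𝟙 (does (i ≟ i₀)) * 1)
      ≡⟨ sum-pick (λ _ → 1) i₀ ⟩
    1 ∎
    where
    open ≡-Reasoning
    x≡gi⇒i≡i₀ : ∀ {i} → x ≡ g i → i ≡ i₀
    x≡gi⇒i≡i₀ x≡gi = injective (trans (sym x≡gi) (sym gi₀≡x))
  preimage-count x | false = trans (sum-cong-≗ (λ i → cong 𝟙 (dec-false (x ≟ g i) x≢gi))) (sum-replicate-zero w)
    where
    x≢gi : ∀ {i} → x ≢ g i
    x≢gi {i} refl with () ← trans (sym ([]=⇒lookup (into i))) x∈S

  sum-image : (c : Fin N → ℕ) → ∑[ i < w ] (c (g i)) ≡ ∑[ x < N ] (𝟙 (lookup S x) * c x)
  sum-image c = begin
    ∑[ i < w ] (c (g i))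
      ≡⟨ sum-cong-≗ (λ i → sym (sum-pick c (g i))) ⟩
    ∑[ i < w ] ∑[ x < N ] (𝟙 (does (x ≟ g i)) * c x)
      ≡⟨ ∑-comm (λ i x → 𝟙 (does (x ≟ g i)) * c x) ⟩
    ∑[ x < N ] ∑[ i < w ] (𝟙 (does (x ≟ g i)) * c x)
      ≡⟨ sum-cong-≗ (λ x → trans (sym (*-distribʳ-sum (c x) (λ i → 𝟙 (does (x ≟ g i))))) (cong (_* c x) (preimage-count x))) ⟩
    ∑[ x < N ] (𝟙 (lookup S x) * c x) ∎
    where open ≡-Reasoning

∣tabulate∣ : ∀ {n} (P : Fin n → Bool) → ∣ tabulate P ∣ ≡ ∑[ x < n ] (𝟙 (P x))
∣tabulate∣ {zero}  P = refl
∣tabulate∣ {suc n} P with P F.zero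
... | true  = cong suc (∣tabulate∣ (P ∘ F.suc))
... | false = ∣tabulate∣ (P ∘ F.suc)

tabulate-─ : ∀ {n} (P Q : Fin n → Bool) →
  tabulate P ─ tabulate Q ≡ tabulate (λ x → not (Q x) ∧ P x)
tabulate-─ {zero}  P Q = refl
tabulate-─ {suc n} P Q with Q F.zero
... | true  = cong (false ∷_) (tabulate-─ (P ∘ F.suc) (Q ∘ F.suc))
... | false = cong (P F.zero ∷_) (tabulate-─ (P ∘ F.suc) (Q ∘ F.suc))

-- Among the indices i < w, exactly a ∸ b satisfy b ≤ i < a (for a ≤ w).
-- For b = 0 the summand is definitionally 𝟙 (i <ᵇ a), so this also counts
-- the indices below a.
count-band : ∀ w a b → a ≤ w →
  ∑[ i < w ] (𝟙 (not (toℕ i <ᵇ b) ∧ (toℕ i <ᵇ a))) ≡ a ∸ b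
count-band w       zero    b       _   = begin
  ∑[ i < w ] (𝟙 (not (toℕ i <ᵇ b) ∧ false)) ≡⟨ sum-cong-≗ (λ (i : Fin w) → cong 𝟙 (∧-zeroʳ (not (toℕ i <ᵇ b)))) ⟩
  ∑[ i < w ] 0                               ≡⟨ sum-replicate-zero w ⟩
  0                                          ≡⟨ sym (0∸n≡0 b) ⟩
  0 ∸ b                                      ∎
  where open ≡-Reasoning
count-band (suc w) (suc a) zero    (s≤s a≤w) = cong suc (count-band w a zero a≤w)
count-band (suc w) (suc a) (suc b) (s≤s a≤w) = count-band w a b a≤w

workersOn-sum : ∀ {w t} (f : Fin w → Fin t) j → workersOn f j ≡ ∑[ i < w ] (𝟙 (does (f i ≟ j)))
workersOn-sum {zero}  f j = refl
workersOn-sum {suc w} f j with f F.zero ≟ j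
... | yes _ = cong suc (workersOn-sum (f ∘ F.suc) j)
... | no _  = workersOn-sum (f ∘ F.suc) j

switchCount-∘ : ∀ {w m k} (h : Fin m → Fin k) (f g : Fin w → Fin m) →
  switchCount (h ∘ f) (h ∘ g) ≤ switchCount f g
switchCount-∘ {zero}  h f g = z≤n
switchCount-∘ {suc w} h f g with f F.zero ≟ g F.zero | h (f F.zero) ≟ h (g F.zero)
... | yes f₀≡g₀ | no hf₀≢hg₀ = ⊥-elim (hf₀≢hg₀ (cong h f₀≡g₀))
... | no _      | no _       = s≤s (switchCount-∘ h (f ∘ F.suc) (g ∘ F.suc))
... | _         | yes _      = ≤-trans (switchCount-∘ h (f ∘ F.suc) (g ∘ F.suc)) (m≤n+m _ _)

module Encoding (w t : ℕ) where

  copy : Fin (w * t) → Fin w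
  copy = quotient t

  task : Fin (w * t) → Fin t
  task = remainder {w} t

  slots : Multiset t → Subset (w * t)
  slots T = tabulate (λ x → toℕ (copy x) <ᵇ T (task x))

  ∣region∣ : (P : Fin w → Fin t → Bool) →
    ∣ tabulate (λ x → P (copy x) (task x)) ∣ ≡ ∑[ j < t ] ∑[ i < w ] (𝟙 (P i j))
  ∣region∣ P = trans (∣tabulate∣ (λ x → P (copy x) (task x))) (sum-grid w t (λ i j → 𝟙 (P i j)))

  -- Multiplicities are bounded by the size; needed to count inside a column.
  multiplicity≤size : (T : Multiset t) → size T ≡ w → ∀ j → T j ≤ w
  multiplicity≤size T ∣T∣≡w j = subst (T j ≤_) (trans (sym (sumFin≡sum t T)) ∣T∣≡w) (term≤sum T j)

  slots-─ : (T₁ T₂ : Multiset t) → size T₁ ≡ w → ∣ slots T₁ ─ slots T₂ ∣ ≡ size (T₁ ∖ T₂)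
  slots-─ T₁ T₂ ∣T₁∣≡w = begin
    ∣ slots T₁ ─ slots T₂ ∣
      ≡⟨ cong ∣_∣ (tabulate-─ (λ x → toℕ (copy x) <ᵇ T₁ (task x)) (λ x → toℕ (copy x) <ᵇ T₂ (task x))) ⟩
    ∣ tabulate (λ x → P (copy x) (task x)) ∣
      ≡⟨ ∣region∣ P ⟩
    ∑[ j < t ] ∑[ i < w ] (𝟙 (P i j))
      ≡⟨ sum-cong-≗ (λ j → count-band w (T₁ j) (T₂ j) (multiplicity≤size T₁ ∣T₁∣≡w j)) ⟩
    ∑[ j < t ] (T₁ j ∸ T₂ j)
      ≡⟨ sym (sumFin≡sum t (T₁ ∖ T₂)) ⟩
    size (T₁ ∖ T₂) ∎
    where
    open ≡-Reasoning
    P : Fin w → Fin t → Bool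
    P i j = not (toℕ i <ᵇ T₂ j) ∧ (toℕ i <ᵇ T₁ j)

  ∣slots∣ : (T : Multiset t) → size T ≡ w → ∣ slots T ∣ ≡ w
  ∣slots∣ T ∣T∣≡w = begin
    ∣ slots T ∣
      ≡⟨ ∣region∣ (λ i j → toℕ i <ᵇ T j) ⟩
    ∑[ j < t ] ∑[ i < w ] (𝟙 (toℕ i <ᵇ T j))
      ≡⟨ sum-cong-≗ (λ j → count-band w (T j) 0 (multiplicity≤size T ∣T∣≡w j)) ⟩
    ∑[ j < t ] (T j)
      ≡⟨ sym (sumFin≡sum t T) ⟩
    size T
      ≡⟨ ∣T∣≡w ⟩
    w ∎
    where open ≡-Reasoning

  slots-adjacent : (T₁ T₂ : Multiset t) → size T₁ ≡ w → size T₂ ≡ w →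
    AdjacentMultisets T₁ T₂ → AdjacentSets (slots T₁) (slots T₂)
  slots-adjacent T₁ T₂ ∣T₁∣≡w ∣T₂∣≡w (∣T₁∖T₂∣≡1 , ∣T₂∖T₁∣≡1) =
    trans (slots-─ T₁ T₂ ∣T₁∣≡w) ∣T₁∖T₂∣≡1 , trans (slots-─ T₂ T₁ ∣T₂∣≡w) ∣T₂∖T₁∣≡1

  ∣slots∩column∣ : (T : Multiset t) → size T ≡ w → ∀ j →
    ∑[ x < w * t ] (𝟙 (does (task x ≟ j)) * 𝟙 (lookup (slots T) x)) ≡ T j
  ∣slots∩column∣ T ∣T∣≡w j = begin
    ∑[ x < w * t ] (𝟙 (does (task x ≟ j)) * 𝟙 (lookup (slots T) x))
      ≡⟨ sum-cong-≗ (λ x → cong (λ b → 𝟙 (does (task x ≟ j)) * 𝟙 b) (lookup∘tabulate _ x)) ⟩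
    ∑[ x < w * t ] (𝟙 (does (task x ≟ j)) * 𝟙 (toℕ (copy x) <ᵇ T (task x)))
      ≡⟨ sum-grid w t (λ i k → 𝟙 (does (k ≟ j)) * 𝟙 (toℕ i <ᵇ T k)) ⟩
    ∑[ k < t ] ∑[ i < w ] (𝟙 (does (k ≟ j)) * 𝟙 (toℕ i <ᵇ T k))
      ≡⟨ sum-cong-≗ (λ k → sym (*-distribˡ-sum (𝟙 (does (k ≟ j))) (λ (i : Fin w) → 𝟙 (toℕ i <ᵇ T k)))) ⟩
    ∑[ k < t ] (𝟙 (does (k ≟ j)) * ∑[ i < w ] (𝟙 (toℕ i <ᵇ T k)))
      ≡⟨ sum-cong-≗ (λ k → cong (𝟙 (does (k ≟ j)) *_) (count-band w (T k) 0 (multiplicity≤size T ∣T∣≡w k))) ⟩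
    ∑[ k < t ] (𝟙 (does (k ≟ j)) * T k)
      ≡⟨ sum-pick T j ⟩
    T j ∎
    where open ≡-Reasoning

  module Induced (φ : SetAssignment w (w * t)) where
    open SetAssignment φ

    cells : (T : Multiset t) → size T ≡ w → Fin w → Fin (w * t)
    cells T ∣T∣≡w = assign (slots T) (∣slots∣ T ∣T∣≡w)

    induced : MultisetAssignment w t
    MultisetAssignment.assign induced T ∣T∣≡w = task ∘ cells T ∣T∣≡w
    MultisetAssignment.mult   induced T ∣T∣≡w j = begin
      workersOn (task ∘ cells T ∣T∣≡w) j
        ≡⟨ workersOn-sum (task ∘ cells T ∣T∣≡w) j ⟩
      ∑[ i < w ] (𝟙 (does (task (cells T ∣T∣≡w i) ≟ j)))
        ≡⟨ Bijection.sum-image (slots T) (cells T ∣T∣≡w) (into _ _) (injective _ _) (onto _ _)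
             (λ x → 𝟙 (does (task x ≟ j))) ⟩
      ∑[ x < w * t ] (𝟙 (lookup (slots T) x) * 𝟙 (does (task x ≟ j)))
        ≡⟨ sum-cong-≗ (λ x → *-comm (𝟙 (lookup (slots T) x)) _) ⟩
      ∑[ x < w * t ] (𝟙 (does (task x ≟ j)) * 𝟙 (lookup (slots T) x))
        ≡⟨ ∣slots∩column∣ T ∣T∣≡w j ⟩
      T j ∎
      where open ≡-Reasoning

    induced-cost : ∀ s → SetCostAtMost φ s → MultisetCostAtMost induced s
    induced-cost s cost T₁ T₂ ∣T₁∣≡w ∣T₂∣≡w T₁~T₂ =
      ≤-trans (switchCount-∘ task (cells T₁ ∣T₁∣≡w) (cells T₂ ∣T₂∣≡w))
              (cost (slots T₁) (slots T₂) _ _ (slots-adjacent T₁ T₂ ∣T₁∣≡w ∣T₂∣≡w T₁~T₂))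

-- Main theorem: the induced assignment witnesses the claim.
lemma5 : (w t : ℕ) → 1 ≤ w → 1 ≤ t →
    (φ : SetAssignment w (w * t)) → (s : ℕ) → SetCostAtMost φ s →
    ∃ λ (φ′ : MultisetAssignment w t) → MultisetCostAtMost φ′ s
lemma5 w t _ _ φ s cost = induced , induced-cost s cost
  where open Encoding.Induced w t φ
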